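{- Let $N\ge1$, $0\le r\le N$, $\lambda\in\mathbb{C}$, and let $f$ be a vertex function on $\mathcal{C}_3^N$ supported in $\Sigma_r=\{v:d(v)=r\}$ with $A_0f=\lambda f$. Then $A_+f$ is supported in $\Sigma_{r+1}$ and $A_0(A_+f)=(\lambda+1)A_+f$.
   Context: Vertices of $\mathcal{C}_3^N$ are elements $v=(\ell_1,\dots,\ell_N)$ of $\mathbb{Z}_3^N$ with $\ell_i\in\{ -1,0,1\}$; $v\sim w$ iff $v-w=\pm e_k$ (mod 3) for some $k$. Levels: $d_k(v)=|\ell_k|$, $d(v)=\sum_kd_k(v)$. $\tilde v_k$ is the vertex obtained from $v$ by replacing $\ell_k$ by $-\ell_k$. Vertex functions are maps $\mathbb{Z}_3^N\to\mathbb{C}$. Outer adjacency: $(A_+f)(v)=\sum_{w\sim v,\ d(w)=d(v)-1}f(w)$; neutral adjacency: $(A_0f)(v)=\sum_{w\sim v,\ d(w)=d(v)}f(w)=\sum_{k:\,d_k(v)=1}f(\tilde v_k)$. -}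

module Defs where

open import Level using (Level)
open import Data.Nat using (ℕ; zero; suc) renaming (_+_ to _+ℕ_)
open import Data.Nat.Properties using () renaming (_≟_ to _≟ℕ_)
open import Data.Fin using (Fin; zero; suc)
open import Data.Vec using (Vec; []; _∷_; zipWith; map; replicate)
open import Data.Vec.Properties using (≡-dec)
open import Data.List using (List; []; _∷_; concatMap; foldr; allFin)
import Data.List as List
open import Data.Bool using (Bool; true; false; _∨_; _∧_; if_then_else_)
open import Data.Bool.ListAction using (any)
open import Relation.Nullary using (Dec; yes; no; ¬_)
open import Relation.Nullary.Decidable using (⌊_⌋)
open import Relation.Binary.PropositionalEquality using (_≡_; refl)
open import Algebra.Bundles using (CommutativeRing)

-- Elements of ℤ₃, represented by ℓ ∈ {-1, 0, 1}.
data Z3 : Set where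
  m1 z0 p1 : Z3

_≟Z3_ : (a b : Z3) → Dec (a ≡ b)
m1 ≟Z3 m1 = yes refl
m1 ≟Z3 z0 = no (λ ())
m1 ≟Z3 p1 = no (λ ())
z0 ≟Z3 m1 = no (λ ())
z0 ≟Z3 z0 = yes refl
z0 ≟Z3 p1 = no (λ ())
p1 ≟Z3 m1 = no (λ ())
p1 ≟Z3 z0 = no (λ ())
p1 ≟Z3 p1 = yes refl

_+₃_ : Z3 → Z3 → Z3
z0 +₃ b  = b
m1 +₃ z0 = m1
m1 +₃ m1 = p1
m1 +₃ p1 = z0
p1 +₃ z0 = p1
p1 +₃ m1 = z0
p1 +₃ p1 = m1

-₃_ : Z3 → Z3
-₃ m1 = p1
-₃ z0 = z0
-₃ p1 = m1

abs₃ : Z3 → ℕ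
abs₃ z0 = 0
abs₃ m1 = 1
abs₃ p1 = 1

Vertex : ℕ → Set
Vertex N = Vec Z3 N

allVertices : (N : ℕ) → List (Vertex N)
allVertices zero = [] ∷ []
allVertices (suc N) =
  concatMap (λ a → List.map (a ∷_) (allVertices N)) (m1 ∷ z0 ∷ p1 ∷ [])

_−ᵥ_ : ∀ {N} → Vertex N → Vertex N → Vertex N
v −ᵥ w = zipWith (λ a b → a +₃ (-₃ b)) v w

negᵥ : ∀ {N} → Vertex N → Vertex N
negᵥ = map -₃_

e : ∀ {N} → Fin N → Vertex N
e {suc N} zero = p1 ∷ replicate N z0
e {suc N} (suc k) = z0 ∷ e k

adjacent : ∀ {N} → Vertex N → Vertex N → Bool
adjacent {N} v w =
  any (λ k → ⌊ ≡-dec _≟Z3_ (v −ᵥ w) (e k) ⌋ ∨ ⌊ ≡-dec _≟Z3_ (v −ᵥ w) (negᵥ (e k)) ⌋)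
           (allFin N)

d : ∀ {N} → Vertex N → ℕ
d [] = 0
d (a ∷ v) = abs₃ a +ℕ d v

module Adjacency {c ℓ : Level} (R : CommutativeRing c ℓ) where
  open CommutativeRing R public using (Carrier; _≈_; _*_; _+_; 0#; 1#)

  sumOver : ∀ {N} → (Vertex N → Bool) → (Vertex N → Carrier) → Carrier
  sumOver {N} P g = foldr (λ w acc → (if P w then g w else 0#) + acc) 0# (allVertices N)

  A₊ : ∀ {N} → (Vertex N → Carrier) → Vertex N → Carrier
  A₊ f v = sumOver (λ w → adjacent w v ∧ ⌊ suc (d w) ≟ℕ d v ⌋) f

  A₀ : ∀ {N} → (Vertex N → Carrier) → Vertex N → Carrier
  A₀ f v = sumOver (λ w → adjacent w v ∧ ⌊ d w ≟ℕ d v ⌋) f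

  SupportedIn : ∀ {N} → (Vertex N → Carrier) → ℕ → Set ℓ
  SupportedIn {N} f r = (v : Vertex N) → ¬ (d v ≡ r) → f v ≈ 0#

-- Two vertices are adjacent exactly when their difference is ±e_k, so A₊ and A₀ can be
-- computed coordinate by coordinate: at a coordinate with ℓ_k ≠ 0, A₊ reads f at the
-- vertex with ℓ_k replaced by 0 and A₀ reads it at ṽ_k. Flipping ℓ_k and then zeroing
-- some nonzero coordinate ℓ_j of the flipped vertex gives A₊f(v) when j = k and the
-- terms of A₊(A₀f)(v) when j ≠ k, hence A₀A₊ = A₊ + A₊A₀ for every f.
-- Support: A₊f(v) only involves values of f one level below v.
module Submission where

open import Defs
open import Data.Nat using (ℕ; zero; suc; _≤_; _≡ᵇ_)
open import Data.Nat.Properties using (≡ᵇ⇒≡; ≡⇒≡ᵇ; 1+n≢n; >⇒≢; n<1+n; m<n⇒m<1+n)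
  renaming (_≟_ to _≟ℕ_)
open import Data.Product using (_×_; _,_)
open import Algebra.Bundles using (CommutativeRing)
open import Data.Fin using (Fin)
open import Data.Vec using ([]; _∷_; replicate)
open import Data.Vec.Properties using (≡-dec; map-replicate)
open import Data.List using (List; []; _∷_; _++_; foldr; tabulate)
open import Data.Bool.ListAction using (or)
import Data.List as List
open import Data.List.Properties using (foldr-map; map-tabulate; tabulate-cong)
open import Data.Bool using (Bool; true; false; T; _∧_; _∨_; if_then_else_)
open import Data.Bool.Properties using (∨-identityʳ)
open import Relation.Nullary using (¬_; Dec; does; yes; no; contradiction)
open import Relation.Nullary.Decidable using (⌊_⌋; isYes≗does)
open import Relation.Binary.PropositionalEquality
  using (_≡_; _≢_; refl; sym; trans; cong; cong₂; ≢-sym; module ≡-Reasoning)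
open import Function using (id; _∘_)
import Algebra.Solver.CommutativeMonoid as CommutativeMonoidSolver
import Relation.Binary.Reasoning.Setoid as SetoidReasoning

infix 4 _≟ᵥ_
_≟ᵥ_ : ∀ {N} (v w : Vertex N) → Dec (v ≡ w)
_≟ᵥ_ = ≡-dec _≟Z3_

isZero : ∀ {N} → Vertex N → Bool
isZero []       = true
isZero (z0 ∷ v) = isZero v
isZero (m1 ∷ _) = false
isZero (p1 ∷ _) = false

isSignedUnit : ∀ {N} → Vertex N → Bool
isSignedUnit []       = false
isSignedUnit (z0 ∷ v) = isSignedUnit v
isSignedUnit (m1 ∷ v) = isZero v
isSignedUnit (p1 ∷ v) = isZero v

does-≟-zeros : ∀ {N} (v : Vertex N) → does (v ≟ᵥ replicate N z0) ≡ isZero v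
does-≟-zeros []       = refl
does-≟-zeros (z0 ∷ v) = does-≟-zeros v
does-≟-zeros (m1 ∷ v) = refl
does-≟-zeros (p1 ∷ v) = refl

does-≟-negᵥ-zeros : ∀ {N} (v : Vertex N) → does (v ≟ᵥ negᵥ (replicate N z0)) ≡ isZero v
does-≟-negᵥ-zeros {N} v =
  trans (cong (does ∘ (v ≟ᵥ_)) (map-replicate -₃_ z0 N)) (does-≟-zeros v)

or-tabulate-false : ∀ n → or (tabulate {n = n} (λ _ → false)) ≡ false
or-tabulate-false zero    = refl
or-tabulate-false (suc n) = or-tabulate-false n

or-tabulate-≟-±e : ∀ {N} (v : Vertex N) →
  or (tabulate (λ k → does (v ≟ᵥ e k) ∨ does (v ≟ᵥ negᵥ (e k)))) ≡ isSignedUnit v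
or-tabulate-≟-±e []                = refl
or-tabulate-≟-±e (z0 ∷ v)          = or-tabulate-≟-±e v
or-tabulate-≟-±e {suc N} (p1 ∷ v)
  rewrite does-≟-zeros v | or-tabulate-false N = trans (∨-identityʳ _) (∨-identityʳ _)
or-tabulate-≟-±e {suc N} (m1 ∷ v)
  rewrite does-≟-negᵥ-zeros v | or-tabulate-false N = ∨-identityʳ _

adjacent≡isSignedUnit : ∀ {N} (w v : Vertex N) → adjacent w v ≡ isSignedUnit (w −ᵥ v)
adjacent≡isSignedUnit {N} w v = begin
  or (List.map isNeighbourAt (tabulate id)) ≡⟨ cong or (map-tabulate id isNeighbourAt) ⟩
  or (tabulate isNeighbourAt)               ≡⟨ cong or (tabulate-cong isYes≗does-at) ⟩
  or (tabulate (λ k → does (w −ᵥ v ≟ᵥ e k) ∨ does (w −ᵥ v ≟ᵥ negᵥ (e k))))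
                                            ≡⟨ or-tabulate-≟-±e (w −ᵥ v) ⟩
  isSignedUnit (w −ᵥ v)                     ∎
  where
  open ≡-Reasoning
  isNeighbourAt : Fin N → Bool
  isNeighbourAt k = ⌊ w −ᵥ v ≟ᵥ e k ⌋ ∨ ⌊ w −ᵥ v ≟ᵥ negᵥ (e k) ⌋

  isYes≗does-at : ∀ k → isNeighbourAt k ≡ does (w −ᵥ v ≟ᵥ e k) ∨ does (w −ᵥ v ≟ᵥ negᵥ (e k))
  isYes≗does-at k = cong₂ _∨_ (isYes≗does (w −ᵥ v ≟ᵥ e k)) (isYes≗does (w −ᵥ v ≟ᵥ negᵥ (e k)))

≡ᵇ-refl : ∀ n → T (n ≡ᵇ n)
≡ᵇ-refl n = ≡⇒≡ᵇ n n refl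

≢⇒¬≡ᵇ : ∀ {m n} → m ≢ n → ¬ T (m ≡ᵇ n)
≢⇒¬≡ᵇ m≢n = m≢n ∘ ≡ᵇ⇒≡ _ _

1+n≢ᵇn : ∀ n → ¬ T (suc n ≡ᵇ n)
1+n≢ᵇn n = ≢⇒¬≡ᵇ (1+n≢n {n})

n≢ᵇ1+n : ∀ n → ¬ T (n ≡ᵇ suc n)
n≢ᵇ1+n n = ≢⇒¬≡ᵇ (≢-sym (1+n≢n {n}))

2+n≢ᵇn : ∀ n → ¬ T (suc (suc n) ≡ᵇ n)
2+n≢ᵇn n = ≢⇒¬≡ᵇ (>⇒≢ (m<n⇒m<1+n (n<1+n n)))

module _ {c ℓ} (R : CommutativeRing c ℓ) where
  open CommutativeRing R
    renaming (refl to ≈-refl; sym to ≈-sym; trans to ≈-trans; reflexive to ≈-reflexive)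
  open Adjacency R using (sumOver; A₊; A₀; SupportedIn)
  open SetoidReasoning setoid
  open CommutativeMonoidSolver +-commutativeMonoid using (solve; _⊜_; _⊕_) renaming (id to ε)

  if-T : ∀ {b} {x y : Carrier} → T b → (if b then x else y) ≈ x
  if-T {true} _ = ≈-refl

  if-¬T : ∀ {b} {x y : Carrier} → ¬ T b → (if b then x else y) ≈ y
  if-¬T {false} _  = ≈-refl
  if-¬T {true}  ¬t = contradiction _ ¬t

  if-⌊⌋≈if-does : ∀ {A : Set} (a? : Dec A) {x y : Carrier} →
                  (if ⌊ a? ⌋ then x else y) ≈ (if does a? then x else y)
  if-⌊⌋≈if-does a? = ≈-reflexive (cong (λ b → if b then _ else _) (isYes≗does a?))

  sumList : ∀ {N} → List (Vertex N) → (Vertex N → Carrier) → Carrier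
  sumList ws h = foldr (λ w acc → h w + acc) 0# ws

  ∑ : ∀ {N} → (Vertex N → Carrier) → Carrier
  ∑ {N} = sumList (allVertices N)

  sumList-cong : ∀ {N} (ws : List (Vertex N)) {g h : Vertex N → Carrier} →
                 (∀ w → g w ≈ h w) → sumList ws g ≈ sumList ws h
  sumList-cong []       g≈h = ≈-refl
  sumList-cong (w ∷ ws) g≈h = +-cong (g≈h w) (sumList-cong ws g≈h)

  sumList-zero : ∀ {N} (ws : List (Vertex N)) {h : Vertex N → Carrier} →
                 (∀ w → h w ≈ 0#) → sumList ws h ≈ 0#
  sumList-zero []       h≈0 = ≈-refl
  sumList-zero (w ∷ ws) h≈0 = ≈-trans (+-cong (h≈0 w) (sumList-zero ws h≈0)) (+-identityˡ 0#)

  sumList-++ : ∀ {N} (ws us : List (Vertex N)) (h : Vertex N → Carrier) →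
               sumList (ws ++ us) h ≈ sumList ws h + sumList us h
  sumList-++ []       us h = ≈-sym (+-identityˡ _)
  sumList-++ (w ∷ ws) us h = ≈-trans (+-congˡ (sumList-++ ws us h)) (≈-sym (+-assoc _ _ _))

  sumList-map : ∀ {M N} (ws : List (Vertex M)) (f : Vertex M → Vertex N) (h : Vertex N → Carrier) →
                sumList (List.map f ws) h ≡ sumList ws (h ∘ f)
  sumList-map ws f h = foldr-map _ f 0# ws

  ∑-cons : ∀ {N} (h : Vertex (suc N) → Carrier) →
           ∑ h ≈ ∑ (h ∘ (m1 ∷_)) + (∑ (h ∘ (z0 ∷_)) + ∑ (h ∘ (p1 ∷_)))
  ∑-cons {N} h = begin
    sumList (Lm ++ (Lz ++ (Lp ++ []))) h                 ≈⟨ sumList-++ Lm _ h ⟩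
    sumList Lm h + sumList (Lz ++ (Lp ++ [])) h         ≈⟨ +-congˡ (sumList-++ Lz _ h) ⟩
    sumList Lm h + (sumList Lz h + sumList (Lp ++ []) h) ≈⟨ +-congˡ (+-congˡ (sumList-++ Lp [] h)) ⟩
    sumList Lm h + (sumList Lz h + (sumList Lp h + 0#)) ≈⟨ +-congˡ (+-congˡ (+-identityʳ _)) ⟩
    sumList Lm h + (sumList Lz h + sumList Lp h)
      ≡⟨ cong₂ _+_ (sumList-map L _ h) (cong₂ _+_ (sumList-map L _ h) (sumList-map L _ h)) ⟩
    ∑ (h ∘ (m1 ∷_)) + (∑ (h ∘ (z0 ∷_)) + ∑ (h ∘ (p1 ∷_))) ∎
    where
    L  = allVertices N
    Lm = List.map (m1 ∷_) L
    Lz = List.map (z0 ∷_) L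
    Lp = List.map (p1 ∷_) L

  ∑-zero : ∀ {N} → ∑ {N} (λ _ → 0#) ≈ 0#
  ∑-zero {N} = sumList-zero (allVertices N) (λ _ → ≈-refl)

  ∑-delta : ∀ {N} (v : Vertex N) (g : Vertex N → Carrier) →
            ∑ (λ w → if isZero (w −ᵥ v) then g w else 0#) ≈ g v
  ∑-delta [] g = +-identityʳ _
  ∑-delta {suc N} (m1 ∷ v) g = ≈-trans (∑-cons {N} _)
    (≈-trans (+-cong (∑-delta v _) (+-cong (∑-zero {N}) (∑-zero {N})))
      (solve 1 (λ x → x ⊕ (ε ⊕ ε) ⊜ x) ≈-refl _))
  ∑-delta {suc N} (z0 ∷ v) g = ≈-trans (∑-cons {N} _)
    (≈-trans (+-cong (∑-zero {N}) (+-cong (∑-delta v _) (∑-zero {N})))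
      (solve 1 (λ x → ε ⊕ (x ⊕ ε) ⊜ x) ≈-refl _))
  ∑-delta {suc N} (p1 ∷ v) g = ≈-trans (∑-cons {N} _)
    (≈-trans (+-cong (∑-zero {N}) (+-cong (∑-zero {N}) (∑-delta v _)))
      (solve 1 (λ x → ε ⊕ (ε ⊕ x) ⊜ x) ≈-refl _))

  neighbourSum : ∀ {N} → (Vertex N → Carrier) → Vertex N → Carrier
  neighbourSum h []       = 0#
  neighbourSum h (m1 ∷ v) = h (z0 ∷ v) + (h (p1 ∷ v) + neighbourSum (h ∘ (m1 ∷_)) v)
  neighbourSum h (z0 ∷ v) = h (m1 ∷ v) + (h (p1 ∷ v) + neighbourSum (h ∘ (z0 ∷_)) v)
  neighbourSum h (p1 ∷ v) = h (m1 ∷ v) + (h (z0 ∷ v) + neighbourSum (h ∘ (p1 ∷_)) v)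

  neighbourSum-cong : ∀ {N} {g h : Vertex N → Carrier} → (∀ w → g w ≈ h w) →
                      ∀ v → neighbourSum g v ≈ neighbourSum h v
  neighbourSum-cong g≈h []       = ≈-refl
  neighbourSum-cong g≈h (m1 ∷ v) = +-cong (g≈h _) (+-cong (g≈h _) (neighbourSum-cong (g≈h ∘ (m1 ∷_)) v))
  neighbourSum-cong g≈h (z0 ∷ v) = +-cong (g≈h _) (+-cong (g≈h _) (neighbourSum-cong (g≈h ∘ (z0 ∷_)) v))
  neighbourSum-cong g≈h (p1 ∷ v) = +-cong (g≈h _) (+-cong (g≈h _) (neighbourSum-cong (g≈h ∘ (p1 ∷_)) v))

  ∑-signedUnit : ∀ {N} (v : Vertex N) (h : Vertex N → Carrier) →
                 ∑ (λ w → if isSignedUnit (w −ᵥ v) then h w else 0#) ≈ neighbourSum h v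
  ∑-signedUnit [] h = +-identityʳ _
  ∑-signedUnit {suc N} (m1 ∷ v) h = ≈-trans (∑-cons {N} _)
    (≈-trans (+-cong (∑-signedUnit v _) (+-cong (∑-delta v _) (∑-delta v _)))
      (solve 3 (λ n a b → n ⊕ (a ⊕ b) ⊜ a ⊕ (b ⊕ n)) ≈-refl _ _ _))
  ∑-signedUnit {suc N} (z0 ∷ v) h = ≈-trans (∑-cons {N} _)
    (≈-trans (+-cong (∑-delta v _) (+-cong (∑-signedUnit v _) (∑-delta v _)))
      (solve 3 (λ a n b → a ⊕ (n ⊕ b) ⊜ a ⊕ (b ⊕ n)) ≈-refl _ _ _))
  ∑-signedUnit {suc N} (p1 ∷ v) h = ≈-trans (∑-cons {N} _)
    (+-cong (∑-delta v _) (+-cong (∑-delta v _) (∑-signedUnit v _)))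

  sumOver-adjacent : ∀ {N} (P : Vertex N → Bool) (g : Vertex N → Carrier) (v : Vertex N) →
    sumOver (λ w → adjacent w v ∧ P w) g ≈ neighbourSum (λ w → if P w then g w else 0#) v
  sumOver-adjacent {N} P g v = ≈-trans (sumList-cong (allVertices N) split) (∑-signedUnit v _)
    where
    split : ∀ w → (if adjacent w v ∧ P w then g w else 0#)
                ≈ (if isSignedUnit (w −ᵥ v) then (if P w then g w else 0#) else 0#)
    split w rewrite adjacent≡isSignedUnit w v with isSignedUnit (w −ᵥ v)
    ... | true  = ≈-refl
    ... | false = ≈-refl

  outer : ∀ {N} → (Vertex N → Carrier) → Vertex N → Carrier
  outer f []       = 0#
  outer f (m1 ∷ v) = f (z0 ∷ v) + outer (f ∘ (m1 ∷_)) v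
  outer f (z0 ∷ v) = outer (f ∘ (z0 ∷_)) v
  outer f (p1 ∷ v) = f (z0 ∷ v) + outer (f ∘ (p1 ∷_)) v

  neutral : ∀ {N} → (Vertex N → Carrier) → Vertex N → Carrier
  neutral f []       = 0#
  neutral f (m1 ∷ v) = f (p1 ∷ v) + neutral (f ∘ (m1 ∷_)) v
  neutral f (z0 ∷ v) = neutral (f ∘ (z0 ∷_)) v
  neutral f (p1 ∷ v) = f (m1 ∷ v) + neutral (f ∘ (p1 ∷_)) v

  -- Levels are compared with _≡ᵇ_, to which does (m ≟ℕ n) computes: it strips a common suc,
  -- so the condition at w = a ∷ w′ is again a level condition on w′.
  neighbourSum-levelBelow : ∀ {N} (v : Vertex N) (f : Vertex N → Carrier) →
    neighbourSum (λ w → if suc (d w) ≡ᵇ d v then f w else 0#) v ≈ outer f v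
  neighbourSum-levelBelow [] f = ≈-refl
  neighbourSum-levelBelow (m1 ∷ v) f = +-cong (if-T (≡ᵇ-refl (d v)))
    (≈-trans (+-cong (if-¬T (1+n≢ᵇn (d v))) (neighbourSum-levelBelow v _)) (+-identityˡ _))
  neighbourSum-levelBelow (z0 ∷ v) f = ≈-trans
    (+-cong (if-¬T (2+n≢ᵇn (d v))) (+-cong (if-¬T (2+n≢ᵇn (d v))) (neighbourSum-levelBelow v _)))
    (solve 1 (λ x → ε ⊕ (ε ⊕ x) ⊜ x) ≈-refl _)
  neighbourSum-levelBelow (p1 ∷ v) f = ≈-trans
    (+-cong (if-¬T (1+n≢ᵇn (d v))) (+-cong (if-T (≡ᵇ-refl (d v))) (neighbourSum-levelBelow v _)))
    (+-identityˡ _)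

  neighbourSum-sameLevel : ∀ {N} (v : Vertex N) (f : Vertex N → Carrier) →
    neighbourSum (λ w → if d w ≡ᵇ d v then f w else 0#) v ≈ neutral f v
  neighbourSum-sameLevel [] f = ≈-refl
  neighbourSum-sameLevel (m1 ∷ v) f = ≈-trans
    (+-cong (if-¬T (n≢ᵇ1+n (d v))) (+-cong (if-T (≡ᵇ-refl (d v))) (neighbourSum-sameLevel v _)))
    (+-identityˡ _)
  neighbourSum-sameLevel (z0 ∷ v) f = ≈-trans
    (+-cong (if-¬T (1+n≢ᵇn (d v))) (+-cong (if-¬T (1+n≢ᵇn (d v))) (neighbourSum-sameLevel v _)))
    (solve 1 (λ x → ε ⊕ (ε ⊕ x) ⊜ x) ≈-refl _)
  neighbourSum-sameLevel (p1 ∷ v) f = +-cong (if-T (≡ᵇ-refl (d v)))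
    (≈-trans (+-cong (if-¬T (n≢ᵇ1+n (d v))) (neighbourSum-sameLevel v _)) (+-identityˡ _))

  A₊≈outer : ∀ {N} (f : Vertex N → Carrier) (v : Vertex N) → A₊ f v ≈ outer f v
  A₊≈outer f v = ≈-trans (sumOver-adjacent _ f v)
    (≈-trans (neighbourSum-cong (λ w → if-⌊⌋≈if-does (suc (d w) ≟ℕ d v)) v) (neighbourSum-levelBelow v f))

  A₀≈neutral : ∀ {N} (f : Vertex N → Carrier) (v : Vertex N) → A₀ f v ≈ neutral f v
  A₀≈neutral f v = ≈-trans (sumOver-adjacent _ f v)
    (≈-trans (neighbourSum-cong (λ w → if-⌊⌋≈if-does (d w ≟ℕ d v)) v) (neighbourSum-sameLevel v f))

  outer-cong : ∀ {N} {f g : Vertex N → Carrier} → (∀ w → f w ≈ g w) →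
               ∀ v → outer f v ≈ outer g v
  outer-cong f≈g []       = ≈-refl
  outer-cong f≈g (m1 ∷ v) = +-cong (f≈g _) (outer-cong (f≈g ∘ (m1 ∷_)) v)
  outer-cong f≈g (z0 ∷ v) = outer-cong (f≈g ∘ (z0 ∷_)) v
  outer-cong f≈g (p1 ∷ v) = +-cong (f≈g _) (outer-cong (f≈g ∘ (p1 ∷_)) v)

  neutral-cong : ∀ {N} {f g : Vertex N → Carrier} → (∀ w → f w ≈ g w) →
                 ∀ v → neutral f v ≈ neutral g v
  neutral-cong f≈g []       = ≈-refl
  neutral-cong f≈g (m1 ∷ v) = +-cong (f≈g _) (neutral-cong (f≈g ∘ (m1 ∷_)) v)
  neutral-cong f≈g (z0 ∷ v) = neutral-cong (f≈g ∘ (z0 ∷_)) v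
  neutral-cong f≈g (p1 ∷ v) = +-cong (f≈g _) (neutral-cong (f≈g ∘ (p1 ∷_)) v)

  interchange : ∀ a b x y → (a + b) + (x + y) ≈ (a + x) + (b + y)
  interchange = solve 4 (λ a b x y → (a ⊕ b) ⊕ (x ⊕ y) ⊜ (a ⊕ x) ⊕ (b ⊕ y)) ≈-refl

  outer-+ : ∀ {N} (f g : Vertex N → Carrier) v →
            outer (λ w → f w + g w) v ≈ outer f v + outer g v
  outer-+ f g []       = ≈-sym (+-identityˡ 0#)
  outer-+ f g (m1 ∷ v) = ≈-trans (+-congˡ (outer-+ _ _ v)) (interchange _ _ _ _)
  outer-+ f g (z0 ∷ v) = outer-+ _ _ v
  outer-+ f g (p1 ∷ v) = ≈-trans (+-congˡ (outer-+ _ _ v)) (interchange _ _ _ _)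

  neutral-+ : ∀ {N} (f g : Vertex N → Carrier) v →
              neutral (λ w → f w + g w) v ≈ neutral f v + neutral g v
  neutral-+ f g []       = ≈-sym (+-identityˡ 0#)
  neutral-+ f g (m1 ∷ v) = ≈-trans (+-congˡ (neutral-+ _ _ v)) (interchange _ _ _ _)
  neutral-+ f g (z0 ∷ v) = neutral-+ _ _ v
  neutral-+ f g (p1 ∷ v) = ≈-trans (+-congˡ (neutral-+ _ _ v)) (interchange _ _ _ _)

  outer-* : ∀ {N} (μ : Carrier) (f : Vertex N → Carrier) v →
            outer (λ w → μ * f w) v ≈ μ * outer f v
  outer-* μ f []       = ≈-sym (zeroʳ μ)
  outer-* μ f (m1 ∷ v) = ≈-trans (+-congˡ (outer-* μ _ v)) (≈-sym (distribˡ μ _ _))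
  outer-* μ f (z0 ∷ v) = outer-* μ _ v
  outer-* μ f (p1 ∷ v) = ≈-trans (+-congˡ (outer-* μ _ v)) (≈-sym (distribˡ μ _ _))

  -- At a coordinate ℓ = ±1 of v, zeroed, flipped and kept are f with that coordinate set to 0, -ℓ, ℓ.
  neutral∘outer-nonzeroCoordinate : ∀ {N} (zeroed flipped kept : Vertex N → Carrier) v →
    neutral (outer kept) v ≈ outer kept v + outer (neutral kept) v →
    (zeroed v + outer flipped v) + neutral (λ w → zeroed w + outer kept w) v
      ≈ (zeroed v + outer kept v) + (neutral zeroed v + outer (λ w → flipped w + neutral kept w) v)
  neutral∘outer-nonzeroCoordinate zeroed flipped kept v hyp = begin
    (zeroed v + outer flipped v) + neutral (λ w → zeroed w + outer kept w) v
      ≈⟨ +-congˡ (≈-trans (neutral-+ zeroed (outer kept) v) (+-congˡ hyp)) ⟩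
    (zeroed v + outer flipped v) + (neutral zeroed v + (outer kept v + outer (neutral kept) v))
      ≈⟨ solve 5 (λ a p z q r → (a ⊕ p) ⊕ (z ⊕ (q ⊕ r)) ⊜ (a ⊕ q) ⊕ (z ⊕ (p ⊕ r)))
                 ≈-refl _ _ _ _ _ ⟩
    (zeroed v + outer kept v) + (neutral zeroed v + (outer flipped v + outer (neutral kept) v))
      ≈⟨ +-congˡ (+-congˡ (≈-sym (outer-+ flipped (neutral kept) v))) ⟩
    (zeroed v + outer kept v) + (neutral zeroed v + outer (λ w → flipped w + neutral kept w) v) ∎

  neutral∘outer≈outer+outer∘neutral : ∀ {N} (f : Vertex N → Carrier) v →
    neutral (outer f) v ≈ outer f v + outer (neutral f) v
  neutral∘outer≈outer+outer∘neutral f []       = ≈-sym (+-identityˡ 0#)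
  neutral∘outer≈outer+outer∘neutral f (m1 ∷ v) =
    neutral∘outer-nonzeroCoordinate (f ∘ (z0 ∷_)) (f ∘ (p1 ∷_)) (f ∘ (m1 ∷_)) v
      (neutral∘outer≈outer+outer∘neutral (f ∘ (m1 ∷_)) v)
  neutral∘outer≈outer+outer∘neutral f (z0 ∷ v) =
    neutral∘outer≈outer+outer∘neutral (f ∘ (z0 ∷_)) v
  neutral∘outer≈outer+outer∘neutral f (p1 ∷ v) =
    neutral∘outer-nonzeroCoordinate (f ∘ (z0 ∷_)) (f ∘ (m1 ∷_)) (f ∘ (p1 ∷_)) v
      (neutral∘outer≈outer+outer∘neutral (f ∘ (p1 ∷_)) v)

  A₊-supportedIn : ∀ {N} {f : Vertex N → Carrier} {r} →
                   SupportedIn f r → SupportedIn (A₊ f) (suc r)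
  A₊-supportedIn {N} {f} f⊆Σr v dv≢1+r = sumList-zero (allVertices N) term≈0
    where
    term≈0 : ∀ w → (if adjacent w v ∧ ⌊ suc (d w) ≟ℕ d v ⌋ then f w else 0#) ≈ 0#
    term≈0 w with adjacent w v | suc (d w) ≟ℕ d v
    ... | false | _           = ≈-refl
    ... | true  | no _        = ≈-refl
    ... | true  | yes 1+dw≡dv = f⊆Σr w (λ dw≡r → dv≢1+r (trans (sym 1+dw≡dv) (cong suc dw≡r)))

  A₊-eigenfunction : ∀ {N} (μ : Carrier) (f : Vertex N → Carrier) →
    (∀ v → A₀ f v ≈ μ * f v) → ∀ v → A₀ (A₊ f) v ≈ (μ + 1#) * A₊ f v
  A₊-eigenfunction μ f A₀f≈μf v = begin
    A₀ (A₊ f) v                         ≈⟨ A₀≈neutral (A₊ f) v ⟩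
    neutral (A₊ f) v                    ≈⟨ neutral-cong (A₊≈outer f) v ⟩
    neutral (outer f) v                 ≈⟨ neutral∘outer≈outer+outer∘neutral f v ⟩
    outer f v + outer (neutral f) v     ≈⟨ +-congˡ (outer-cong neutralf≈μf v) ⟩
    outer f v + outer (λ w → μ * f w) v ≈⟨ +-congˡ (outer-* μ f v) ⟩
    outer f v + μ * outer f v           ≈⟨ +-congʳ (≈-sym (*-identityˡ _)) ⟩
    1# * outer f v + μ * outer f v      ≈⟨ ≈-sym (distribʳ _ 1# μ) ⟩
    (1# + μ) * outer f v                ≈⟨ *-cong (+-comm 1# μ) (≈-sym (A₊≈outer f v)) ⟩
    (μ + 1#) * A₊ f v                   ∎
    where
    neutralf≈μf : ∀ w → neutral f w ≈ μ * f w
    neutralf≈μf w = ≈-trans (≈-sym (A₀≈neutral f w)) (A₀f≈μf w)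

mainTheorem4 : ∀ {c ℓ} (R : CommutativeRing c ℓ) →
    let open Adjacency R in
    (N : ℕ) → 1 ≤ N → (r : ℕ) → r ≤ N → (μ : CommutativeRing.Carrier R) (f : Vertex N → Carrier) →
    SupportedIn f r →
    ((v : Vertex N) → A₀ f v ≈ μ * f v) →
    SupportedIn (A₊ f) (suc r) ×
      ((v : Vertex N) → A₀ (A₊ f) v ≈ (μ + 1#) * A₊ f v)
mainTheorem4 R N _ r _ μ f f⊆Σr A₀f≈μf = A₊-supportedIn R f⊆Σr , A₊-eigenfunction R μ f A₀f≈μf
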